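{- Let $f,g,h,k$ be complex numbers with $f\neq 0$ and $g\neq 0$, and let $(R_n)_{n\in\mathbb{Z}}$ be the two-sided sequence with $R_0=h$, $R_1=k$ and $R_{n+1}=fR_n+gR_{n-1}$ for all $n\in\mathbb{Z}$. Then for all integers $n$ and $i$, $$(k^{2}-fkh-gh^{2})R_{i+n}+(f^{2}h-fk+gh)R_{i}R_{n}+hg^{2}R_{i-1}R_{n-1}+(fh-k)g\left(R_{n}R_{i-1}+R_{i}R_{n-1}\right)=0.$$
   Context: The paper works with complex functions $f(z),g(z),h(z),k(z)$ evaluated at a fixed $z$, with the standing assumption $f\neq0$, $g\neq0$. Since $g\neq0$, the sequence extends to negative indices via $R_{n-1}=(R_{n+1}-fR_n)/g$. -}

module Defs where

open import Level using (Level)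
open import Algebra.Bundles using (CommutativeRing)
open import Data.Integer using (ℤ)
import Data.Integer as Z
open import Data.Product using (_×_)

module _ {c ℓ : Level} (A : CommutativeRing c ℓ) where
  open CommutativeRing A

  IsHoradam : (f g h k : Carrier) → (ℤ → Carrier) → Set ℓ
  IsHoradam f g h k R =
    (R Z.0ℤ ≈ h) × (R Z.1ℤ ≈ k) ×
    (∀ (n : ℤ) → R (n Z.+ Z.1ℤ) ≈ (f * R n) + (g * R (n Z.- Z.1ℤ)))

{-# OPTIONS --safe #-}
-- Write E(n, i) for the left-hand side.  Apart from the term D·R(i+n), where
-- D = k² - fkh - gh², it is a bilinear form in the consecutive pairs
-- (R(i-1), R(i)) and (R(n-1), R(n)) with respect to which the step
-- (x₀, x₁) ↦ (x₁, f x₁ + g x₀) of the recurrence is self-adjoint.  Hence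
-- E(n, i+1) = E(n+1, i), and it suffices to show E(n, 0) = 0.  Using R(0) = h,
-- E(n, 0) factors as (g R(-1) - (k - f h)) (h g R(n-1) + (f h - k) R(n)), and the
-- first factor vanishes because k = R(1) = f h + g R(-1).
module Submission where

open import Algebra.Bundles using (CommutativeRing)
open import Algebra.Bundles.Raw using (RawRing)
open import Algebra.Solver.Ring.AlmostCommutativeRing
  using (fromCommutativeRing; _-Raw-AlmostCommutative⟶_)
open import Data.Integer using (ℤ; +_; -[1+_]; 0ℤ; 1ℤ)
import Data.Integer as Z
import Data.Integer.Properties as ℤₚ
open import Data.Integer.Tactic.RingSolver using (solve-∀)
open import Data.Maybe.Base using (Maybe; map)
open import Data.Nat.Base as ℕ using (ℕ; zero; suc; _∸_)
import Data.Nat.Properties as ℕₚ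
open import Data.Product.Base using (_×_; _,_; proj₁; proj₂)
open import Data.Product.Properties using (≡-dec)
open import Level using (Level; 0ℓ)
open import Relation.Nullary using (¬_)
open import Relation.Nullary.Decidable.Core using (dec⇒maybe)
open import Relation.Binary.PropositionalEquality.Core as ≡ using (_≡_; cong; subst)

open import Defs

module IntegerCoefficientSolver {c ℓ} (A : CommutativeRing c ℓ) where
  open CommutativeRing A
  open import Algebra.Properties.Ring ring
    using (-‿+-comm; ⁻¹-anti-homo‿-; x[y-z]≈xy-xz; [y-z]x≈yx-zx; -0#≈0#)
  open import Algebra.Properties.CommutativeSemigroup +-commutativeSemigroup
    using (interchange)
  open import Algebra.Properties.Semiring.Mult semiring using (×-homo-+; ×1-homo-*) renaming (_×_ to _·_)
  open import Relation.Binary.Reasoning.Setoid setoid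

  +-differences : ∀ x y z w → (x - y) + (z - w) ≈ (x + z) - (y + w)
  +-differences x y z w = begin
    (x - y) + (z - w)     ≈⟨ interchange x (- y) z (- w) ⟩
    (x + z) + (- y + - w) ≈⟨ +-congˡ (-‿+-comm y w) ⟩
    (x + z) - (y + w)     ∎

  *-differences : ∀ x y z w → (x - y) * (z - w) ≈ (x * z + y * w) - (x * w + y * z)
  *-differences x y z w = begin
    (x - y) * (z - w)                 ≈⟨ x[y-z]≈xy-xz (x - y) z w ⟩
    (x - y) * z - (x - y) * w         ≈⟨ +-cong ([y-z]x≈yx-zx z x y) (-‿cong ([y-z]x≈yx-zx w x y)) ⟩
    (x * z - y * z) - (x * w - y * w) ≈⟨ +-congˡ (⁻¹-anti-homo‿- (x * w) (y * w)) ⟩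
    (x * z - y * z) + (y * w - x * w) ≈⟨ +-differences (x * z) (y * z) (y * w) (x * w) ⟩
    (x * z + y * w) - (y * z + x * w) ≈⟨ +-congˡ (-‿cong (+-comm (y * z) (x * w))) ⟩
    (x * z + y * w) - (x * w + y * z) ∎

  -- The pair (m , n) stands for the integer m - n.  Keeping pairs in the normal
  -- form (m ∸ n , n ∸ m) makes equal integers syntactically equal, so that
  -- equal polynomials get identical normal forms and solve … refl succeeds.
  ⟦_⟧ᶜ : ℕ × ℕ → Carrier
  ⟦ m , n ⟧ᶜ = m · 1# - n · 1#

  normalize : ℕ × ℕ → ℕ × ℕ
  normalize (m , n) = m ∸ n , n ∸ m

  ⟦normalize⟧ : ∀ p → ⟦ normalize p ⟧ᶜ ≈ ⟦ p ⟧ᶜ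
  ⟦normalize⟧ (zero  , zero)  = refl
  ⟦normalize⟧ (zero  , suc n) = refl
  ⟦normalize⟧ (suc m , zero)  = refl
  ⟦normalize⟧ (suc m , suc n) = begin
    ⟦ normalize (m , n) ⟧ᶜ              ≈⟨ ⟦normalize⟧ (m , n) ⟩
    ⟦ m , n ⟧ᶜ                          ≈⟨ +-identityˡ ⟦ m , n ⟧ᶜ ⟨
    0# + ⟦ m , n ⟧ᶜ                     ≈⟨ +-congʳ (-‿inverseʳ 1#) ⟨
    (1# - 1#) + ⟦ m , n ⟧ᶜ              ≈⟨ +-differences 1# 1# (m · 1#) (n · 1#) ⟩
    ⟦ suc m , suc n ⟧ᶜ                  ∎

  _+ᶜ_ _*ᶜ_ : ℕ × ℕ → ℕ × ℕ → ℕ × ℕ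
  (a , b) +ᶜ (c , d) = normalize (a ℕ.+ c , b ℕ.+ d)
  (a , b) *ᶜ (c , d) = normalize (a ℕ.* c ℕ.+ b ℕ.* d , a ℕ.* d ℕ.+ b ℕ.* c)

  integers : RawRing 0ℓ 0ℓ
  integers = record
    { Carrier = ℕ × ℕ
    ; _≈_     = _≡_
    ; _+_     = _+ᶜ_
    ; _*_     = _*ᶜ_
    ; -_      = λ (m , n) → n , m
    ; 0#      = 0 , 0
    ; 1#      = 1 , 0
    }

  ×1-homo-+ : ∀ m n → (m ℕ.+ n) · 1# ≈ m · 1# + n · 1#
  ×1-homo-+ = ×-homo-+ 1#

  ×1-homo-*+* : ∀ a b c d → (a ℕ.* b ℕ.+ c ℕ.* d) · 1# ≈ (a · 1#) * (b · 1#) + (c · 1#) * (d · 1#)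
  ×1-homo-*+* a b c d = trans (×1-homo-+ (a ℕ.* b) (c ℕ.* d)) (+-cong (×1-homo-* a b) (×1-homo-* c d))

  ⟦⟧ᶜ-homomorphism : integers -Raw-AlmostCommutative⟶ fromCommutativeRing A
  ⟦⟧ᶜ-homomorphism = record
    { ⟦_⟧    = ⟦_⟧ᶜ
    ; +-homo = λ (a , b) (c , d) → begin
        ⟦ (a , b) +ᶜ (c , d) ⟧ᶜ                ≈⟨ ⟦normalize⟧ (a ℕ.+ c , b ℕ.+ d) ⟩
        (a ℕ.+ c) · 1# - (b ℕ.+ d) · 1#        ≈⟨ +-cong (×1-homo-+ a c) (-‿cong (×1-homo-+ b d)) ⟩
        (a · 1# + c · 1#) - (b · 1# + d · 1#)  ≈⟨ +-differences (a · 1#) (b · 1#) (c · 1#) (d · 1#) ⟨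
        ⟦ a , b ⟧ᶜ + ⟦ c , d ⟧ᶜ                 ∎
    ; *-homo = λ (a , b) (c , d) → begin
        ⟦ (a , b) *ᶜ (c , d) ⟧ᶜ                ≈⟨ ⟦normalize⟧ (a ℕ.* c ℕ.+ b ℕ.* d , a ℕ.* d ℕ.+ b ℕ.* c) ⟩
        ⟦ a ℕ.* c ℕ.+ b ℕ.* d , a ℕ.* d ℕ.+ b ℕ.* c ⟧ᶜ
          ≈⟨ +-cong (×1-homo-*+* a c b d) (-‿cong (×1-homo-*+* a d b c)) ⟩
        (a · 1# * (c · 1#) + b · 1# * (d · 1#)) - (a · 1# * (d · 1#) + b · 1# * (c · 1#))
          ≈⟨ *-differences (a · 1#) (b · 1#) (c · 1#) (d · 1#) ⟨
        ⟦ a , b ⟧ᶜ * ⟦ c , d ⟧ᶜ                 ∎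
    ; -‿homo = λ (a , b) → sym (⁻¹-anti-homo‿- (a · 1#) (b · 1#))
    ; 0-homo = -‿inverseʳ 0#
    ; 1-homo = trans (+-congˡ -0#≈0#) (trans (+-identityʳ _) (+-identityʳ 1#))
    }

  _≟ᶜ_ : ∀ p q → Maybe (⟦ p ⟧ᶜ ≈ ⟦ q ⟧ᶜ)
  p ≟ᶜ q = map (λ p≡q → reflexive (cong ⟦_⟧ᶜ p≡q)) (dec⇒maybe (≡-dec ℕₚ._≟_ ℕₚ._≟_ p q))

  open import Algebra.Solver.Ring integers (fromCommutativeRing A) ⟦⟧ᶜ-homomorphism _≟ᶜ_
    public using (Polynomial; solve; _:=_; _:+_; _:*_; _:-_; :-_; con)

  polynomials : ℕ → RawRing 0ℓ 0ℓ
  polynomials n = record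
    { Carrier = Polynomial n
    ; _≈_     = _≡_
    ; _+_     = _:+_
    ; _*_     = _:*_
    ; -_      = :-_
    ; 0#      = con (0 , 0)
    ; 1#      = con (1 , 0)
    }

-- Stated for an arbitrary raw ring so that the solver can instantiate it with polynomials.
module _ {a ℓ} (ring : RawRing a ℓ) where
  open RawRing ring

  private
    infixl 6 _-_
    _-_ : Carrier → Carrier → Carrier
    x - y = x + - y

  horadamForm : (f g h k s x₀ x₁ y₀ y₁ : Carrier) → Carrier
  horadamForm f g h k s x₀ x₁ y₀ y₁ =
    ((((((k * k) - (f * k * h)) - (g * h * h)) * s)
      + ((((f * f * h) - (f * k)) + (g * h)) * (x₁ * y₁)))
      + (h * (g * g) * (x₀ * y₀)))
      + (((f * h) - k) * g * ((y₁ * x₀) + (x₁ * y₀)))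

module HoradamForm {c ℓ} (A : CommutativeRing c ℓ) where
  open CommutativeRing A
  open IntegerCoefficientSolver A

  Φ : (f g h k s x₀ x₁ y₀ y₁ : Carrier) → Carrier
  Φ = horadamForm rawRing

  Φᴾ : ∀ {n} (f g h k s x₀ x₁ y₀ y₁ : Polynomial n) → Polynomial n
  Φᴾ {n} = horadamForm (polynomials n)

  Φ-adjoint : ∀ f g h k s x₀ x₁ y₀ y₁ →
    Φ f g h k s x₁ (f * x₁ + g * x₀) y₀ y₁ ≈ Φ f g h k s x₀ x₁ y₁ (f * y₁ + g * y₀)
  Φ-adjoint = solve 9 (λ f g h k s x₀ x₁ y₀ y₁ →
    Φᴾ f g h k s x₁ (f :* x₁ :+ g :* x₀) y₀ y₁ := Φᴾ f g h k s x₀ x₁ y₁ (f :* y₁ :+ g :* y₀)) refl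

  Φ-cong : ∀ f g h k {s s′ x₀ x₀′ x₁ x₁′ y₀ y₀′ y₁ y₁′} →
    s ≈ s′ → x₀ ≈ x₀′ → x₁ ≈ x₁′ → y₀ ≈ y₀′ → y₁ ≈ y₁′ →
    Φ f g h k s x₀ x₁ y₀ y₁ ≈ Φ f g h k s′ x₀′ x₁′ y₀′ y₁′
  Φ-cong f g h k s≈ x₀≈ x₁≈ y₀≈ y₁≈ =
    +-cong (+-cong (+-cong (*-congˡ s≈) (*-congˡ (*-cong x₁≈ y₁≈))) (*-congˡ (*-cong x₀≈ y₀≈)))
           (*-congˡ (+-cong (*-cong y₁≈ x₀≈) (*-cong x₁≈ y₀≈)))

  Φ-factor : ∀ f g h k u y₀ y₁ →
    Φ f g h k y₁ u h y₀ y₁ ≈ (g * u - (k - f * h)) * (h * g * y₀ + (f * h - k) * y₁)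
  Φ-factor = solve 7 (λ f g h k u y₀ y₁ →
    Φᴾ f g h k y₁ u h y₀ y₁ := (g :* u :- (k :- f :* h)) :* (h :* g :* y₀ :+ (f :* h :- k) :* y₁)) refl

ℤ-induction : ∀ {p} (P : ℤ → Set p) → P 0ℤ →
  (∀ i → P i → P (i Z.+ 1ℤ)) → (∀ i → P (i Z.+ 1ℤ) → P i) → ∀ i → P i
ℤ-induction P P₀ up down = go
  where
  go : ∀ i → P i
  go (+ zero)     = P₀
  go (+ suc m)    = subst P (cong +_ (ℕₚ.+-comm m 1)) (up (+ m) (go (+ m)))
  go -[1+ zero ]  = down -[1+ zero ] P₀
  go -[1+ suc m ] = down -[1+ suc m ] (go -[1+ m ])

i+1-1≡i : ∀ i → i Z.+ 1ℤ Z.- 1ℤ ≡ i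
i+1-1≡i = solve-∀

i-1+1≡i : ∀ i → i Z.- 1ℤ Z.+ 1ℤ ≡ i
i-1+1≡i = solve-∀

[i+1]+n≡i+[n+1] : ∀ i n → i Z.+ 1ℤ Z.+ n ≡ i Z.+ (n Z.+ 1ℤ)
[i+1]+n≡i+[n+1] = solve-∀

module Horadam {c ℓ} (A : CommutativeRing c ℓ) {f g h k : CommutativeRing.Carrier A}
  {R : ℤ → CommutativeRing.Carrier A} (isHoradam : IsHoradam A f g h k R) where

  open CommutativeRing A
  open HoradamForm A
  open import Algebra.Properties.Ring ring using (xyx⁻¹≈y; x≈y⇒x∙y⁻¹≈ε)
  open import Relation.Binary.Reasoning.Setoid setoid

  private
    R₀≈h : R 0ℤ ≈ h
    R₀≈h = proj₁ isHoradam

    R₁≈k : R 1ℤ ≈ k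
    R₁≈k = proj₁ (proj₂ isHoradam)

    recurrence : ∀ n → R (n Z.+ 1ℤ) ≈ f * R n + g * R (n Z.- 1ℤ)
    recurrence = proj₂ (proj₂ isHoradam)

    R-≡ : ∀ {i j} → i ≡ j → R i ≈ R j
    R-≡ i≡j = reflexive (cong R i≡j)

  E : ℤ → ℤ → Carrier
  E n i = Φ f g h k (R (i Z.+ n)) (R (i Z.- 1ℤ)) (R i) (R (n Z.- 1ℤ)) (R n)

  E-shift : ∀ n i → E n (i Z.+ 1ℤ) ≈ E (n Z.+ 1ℤ) i
  E-shift n i = begin
    E n (i Z.+ 1ℤ)
      ≈⟨ Φ-cong f g h k (R-≡ ([i+1]+n≡i+[n+1] i n)) (R-≡ (i+1-1≡i i)) (recurrence i) refl refl ⟩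
    Φ f g h k (R (i Z.+ (n Z.+ 1ℤ))) (R i) (f * R i + g * R (i Z.- 1ℤ)) (R (n Z.- 1ℤ)) (R n)
      ≈⟨ Φ-adjoint f g h k (R (i Z.+ (n Z.+ 1ℤ))) (R (i Z.- 1ℤ)) (R i) (R (n Z.- 1ℤ)) (R n) ⟩
    Φ f g h k (R (i Z.+ (n Z.+ 1ℤ))) (R (i Z.- 1ℤ)) (R i) (R n) (f * R n + g * R (n Z.- 1ℤ))
      ≈⟨ Φ-cong f g h k refl refl refl (R-≡ (≡.sym (i+1-1≡i n))) (sym (recurrence n)) ⟩
    E (n Z.+ 1ℤ) i ∎

  E-at-0 : ∀ n → E n 0ℤ ≈ 0#
  E-at-0 n = begin
    E n 0ℤ                                    ≈⟨ Φ-cong f g h k (R-≡ (ℤₚ.+-identityˡ n)) refl R₀≈h refl refl ⟩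
    Φ f g h k (R n) u h (R (n Z.- 1ℤ)) (R n)  ≈⟨ Φ-factor f g h k u (R (n Z.- 1ℤ)) (R n) ⟩
    (g * u - (k - f * h)) * Y                 ≈⟨ *-congʳ (x≈y⇒x∙y⁻¹≈ε (sym k-fh≈gu)) ⟩
    0# * Y                                    ≈⟨ zeroˡ Y ⟩
    0#                                        ∎
    where
    u Y : Carrier
    u = R (0ℤ Z.- 1ℤ)
    Y = h * g * R (n Z.- 1ℤ) + (f * h - k) * R n

    k-fh≈gu : k - f * h ≈ g * u
    k-fh≈gu = begin
      k - f * h                 ≈⟨ +-congʳ (trans (sym R₁≈k) (trans (recurrence 0ℤ) (+-congʳ (*-congˡ R₀≈h)))) ⟩
      (f * h + g * u) - f * h   ≈⟨ xyx⁻¹≈y (f * h) (g * u) ⟩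
      g * u                     ∎

  E-vanishes : ∀ i n → E n i ≈ 0#
  E-vanishes = ℤ-induction (λ i → ∀ n → E n i ≈ 0#) E-at-0
    (λ i Eᵢ≈0 n → trans (E-shift n i) (Eᵢ≈0 (n Z.+ 1ℤ)))
    (λ i Eᵢ₊₁≈0 n → begin
      E n i                    ≡⟨ cong (λ m → E m i) (≡.sym (i-1+1≡i n)) ⟩
      E (n Z.- 1ℤ Z.+ 1ℤ) i    ≈⟨ E-shift (n Z.- 1ℤ) i ⟨
      E (n Z.- 1ℤ) (i Z.+ 1ℤ)  ≈⟨ Eᵢ₊₁≈0 (n Z.- 1ℤ) ⟩
      0#                       ∎)

theorem4p2 : {c ℓ : Level} (A : CommutativeRing c ℓ) →
    let open CommutativeRing A in
    (f g h k : Carrier) → ¬ (f ≈ 0#) → ¬ (g ≈ 0#) →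
    (R : ℤ → Carrier) → IsHoradam A f g h k R →
    (n i : ℤ) →
    ((((((k * k) - (f * k * h)) - (g * h * h)) * R (i Z.+ n))
      + ((((f * f * h) - (f * k)) + (g * h)) * (R i * R n)))
      + (h * (g * g) * (R (i Z.- Z.1ℤ) * R (n Z.- Z.1ℤ))))
      + (((f * h) - k) * g * ((R n * R (i Z.- Z.1ℤ)) + (R i * R (n Z.- Z.1ℤ))))
      ≈ 0#
theorem4p2 A f g h k _ _ R isHoradam n i = Horadam.E-vanishes A isHoradam i n
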